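{- Let $f\in E(Q_3)$ and let $M$ be a matching of $Q_3-\{f\}$ with $|M|=2$. Then there exists a Hamiltonian cycle of $Q_3-\{f\}$ containing $M$, except in the following two situations: (i) the two edges of $M$ have the same dimension $i$, are at distance $2$ from each other, and $f$ is also $i$-dimensional; (ii) the two edges of $M$ have different dimensions $a\neq b$, and $f$ is the unique edge of the third dimension $c\notin\{a,b\}$ having no endpoint in common with any edge of $M$.
   Context: $Q_3$ is the 3-dimensional hypercube; an edge is $i$-dimensional if its endpoints differ in coordinate $i$. $Q_3-\{f\}$ is $Q_3$ with the edge $f$ deleted. For edges $uv,xy$, $d(uv,xy)=\min\{d(u,x),d(u,y),d(v,x),d(v,y)\}$ where $d$ is graph distance. A matching is a set of pairwise vertex-disjoint edges. -}

module Defs where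

open import Data.Bool using (Bool)
open import Data.Nat using (ℕ; suc)
open import Data.Fin using (Fin; zero; suc)
open import Data.Vec using (Vec; lookup)
open import Data.Product using (Σ; ∃; _×_)
open import Data.Sum using (_⊎_)
open import Function using (Injective)
open import Relation.Nullary using (¬_)
open import Relation.Binary.PropositionalEquality using (_≡_; _≢_)

V : Set
V = Vec Bool 3

DiffIn : Fin 3 → V → V → Set
DiffIn i u v = (lookup u i ≢ lookup v i) × (∀ j → j ≢ i → lookup u j ≡ lookup v j)

Adj : V → V → Set
Adj u v = ∃ λ i → DiffIn i u v

record Edge : Set where
  constructor edge
  field
    x   : V
    y   : V
    dim : Fin 3
    diff : DiffIn dim x y
open Edge public

SamePair : V → V → V → V → Set
SamePair a b c d = (a ≡ c × b ≡ d) ⊎ (a ≡ d × b ≡ c)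

SameEdge : Edge → Edge → Set
SameEdge e e' = SamePair (x e) (y e) (x e') (y e')

IsEnd : V → Edge → Set
IsEnd v e = (v ≡ x e) ⊎ (v ≡ y e)

ShareEnd : Edge → Edge → Set
ShareEnd e e' = ∃ λ v → IsEnd v e × IsEnd v e'

InQ3minus : Edge → Edge → Set
InQ3minus f e = ¬ SameEdge e f

-- {e₁ , e₂} is a matching of Q₃ - {f} with exactly 2 edges
-- (vertex-disjointness implies e₁ ≠ e₂, so |M| = 2).
Matching2 : Edge → Edge → Edge → Set
Matching2 f e₁ e₂ = InQ3minus f e₁ × InQ3minus f e₂ × ¬ ShareEnd e₁ e₂

-- Walks in Q₃ of length at most n: graph distance d(u,v) ≤ n iff WalkLe n u v.
data WalkLe : ℕ → V → V → Set where
  stay : ∀ {n u} → WalkLe n u u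
  step : ∀ {n u w v} → Adj u w → WalkLe n w v → WalkLe (suc n) u v

-- d(e, e') ≤ n, with d(uv,xy) = min of the four vertex distances.
EdgeDistLe : ℕ → Edge → Edge → Set
EdgeDistLe n e e' = ∃ λ a → ∃ λ b → IsEnd a e × IsEnd b e' × WalkLe n a b

EdgeDist2 : Edge → Edge → Set
EdgeDist2 e e' = EdgeDistLe 2 e e' × ¬ EdgeDistLe 1 e e'

next : Fin 8 → Fin 8
next zero = suc zero
next (suc zero) = suc (suc zero)
next (suc (suc zero)) = suc (suc (suc zero))
next (suc (suc (suc zero))) = suc (suc (suc (suc zero)))
next (suc (suc (suc (suc zero)))) = suc (suc (suc (suc (suc zero))))
next (suc (suc (suc (suc (suc zero))))) = suc (suc (suc (suc (suc (suc zero)))))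
next (suc (suc (suc (suc (suc (suc zero)))))) = suc (suc (suc (suc (suc (suc (suc zero))))))
next (suc (suc (suc (suc (suc (suc (suc zero))))))) = zero

-- A Hamiltonian cycle of Q₃ - {f}: a cyclic ordering c₀ … c₇ of the 8 vertices
-- (injective, hence all vertices), consecutive vertices adjacent in Q₃,
-- and no consecutive pair forming the deleted edge f.
record HamCycle (f : Edge) : Set where
  field
    cyc  : Fin 8 → V
    inj  : Injective _≡_ _≡_ cyc
    adj  : ∀ k → Adj (cyc k) (cyc (next k))
    avoid : ∀ k → ¬ SamePair (cyc k) (cyc (next k)) (x f) (y f)
open HamCycle public

CycleContains : ∀ {f} → HamCycle f → Edge → Set
CycleContains C e = ∃ λ k → SamePair (cyc C k) (cyc C (next k)) (x e) (y e)

Exception1 : Edge → Edge → Edge → Set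
Exception1 f e₁ e₂ = (dim e₁ ≡ dim e₂) × EdgeDist2 e₁ e₂ × (dim f ≡ dim e₁)

FreeEdge : Fin 3 → Edge → Edge → Edge → Set
FreeEdge c e₁ e₂ g = (dim g ≡ c) × ¬ ShareEnd g e₁ × ¬ ShareEnd g e₂

Exception2 : Edge → Edge → Edge → Set
Exception2 f e₁ e₂ =
  (dim e₁ ≢ dim e₂) ×
  Σ (Fin 3) λ c → (c ≢ dim e₁) × (c ≢ dim e₂) ×
    FreeEdge c e₁ e₂ f × (∀ g → FreeEdge c e₁ e₂ g → SameEdge g f)

-- A Hamiltonian cycle of Q₃ is a closed walk visiting all eight vertices, so it is determined by its first
-- vertex c and its word of eight directions; translating by c (an automorphism of Q₃) moves it to the
-- origin without changing the word. Running over all 3⁸ words shows that exactly twelve of them are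
-- Hamiltonian, so the Hamiltonian cycles of Q₃ form an explicit finite list. Translations also preserve
-- matchings, distances and both exceptional configurations, so we may assume that f starts at the
-- origin; for each of the remaining 3 · 24 · 24 configurations, evaluation then shows that either an
-- exception holds and no cycle of the list contains M while avoiding f, or one of them does.

module Submission where

open import Defs
open import Level using (0ℓ)
open import Data.Bool using (Bool; true; false; not; _xor_)
open import Data.Bool.Properties using (not-¬; ¬-not; xor-same; xor-assoc; xor-identityˡ; xor-identityʳ;
  not-distribʳ-xor) renaming (_≟_ to _≟ᵇ_)
open import Data.Nat using (ℕ; zero; suc)
open import Data.Fin using (Fin; zero; suc; inject₁; fromℕ; #_)
open import Data.Fin.Properties using (all?; any?) renaming (_≟_ to _≟ᶠ_)
open import Data.Fin.Relation.Unary.Top using (view; ‵fromℕ; ‵inject₁)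
open import Data.Vec using (Vec; []; _∷_; lookup; updateAt; zipWith; replicate; tabulate)
open import Data.Vec.Properties using (lookup∘updateAt; lookup∘updateAt′; lookup∘tabulate; zipWith-assoc;
  zipWith-identityˡ; zipWith-identityʳ) renaming (≡-dec to ≡-decᵛ)
open import Data.Vec.Relation.Binary.Pointwise.Extensional using (ext; Pointwise-≡⇒≡)
open import Data.List using (List; []; _∷_)
open import Data.List.Relation.Unary.All as All using (All)
open import Data.List.Relation.Unary.Any as Any using (Any)
open import Data.List.Membership.Propositional using (_∈_; find; lose)
open import Data.Product using (Σ; ∃; _×_; _,_; proj₁; proj₂) renaming (map to map×)
open import Data.Sum using (_⊎_; inj₁; inj₂; [_,_]; fromInj₂) renaming (map to map⊎)
open import Function using (_∘_; Injective)
open import Relation.Nullary using (¬_; Dec; yes; no; does; map′; contradiction;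
  _×-dec_; _⊎-dec_; _→-dec_; ¬?)
open import Relation.Unary using (Pred; Decidable)
open import Relation.Binary.Definitions using (DecidableEquality)
open import Relation.Binary.PropositionalEquality hiding ([_])

private
  variable
    m n : ℕ

flipAt : Vec Bool n → Fin n → Vec Bool n
flipAt v i = updateAt v i not

infixl 6 _⊕_
_⊕_ : Vec Bool n → Vec Bool n → Vec Bool n
_⊕_ = zipWith _xor_

0ᵛ : Vec Bool n
0ᵛ = replicate _ false

⊕-identityʳ : (v : Vec Bool n) → v ⊕ 0ᵛ ≡ v
⊕-identityʳ = zipWith-identityʳ xor-identityʳ

⊕-self : (v : Vec Bool n) → v ⊕ v ≡ 0ᵛ
⊕-self []      = refl
⊕-self (b ∷ v) = cong₂ _∷_ (xor-same b) (⊕-self v)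

⊕-cancelˡ : (c v : Vec Bool n) → c ⊕ (c ⊕ v) ≡ v
⊕-cancelˡ c v = begin
  c ⊕ (c ⊕ v)  ≡⟨ zipWith-assoc xor-assoc c c v ⟨
  (c ⊕ c) ⊕ v  ≡⟨ cong (_⊕ v) (⊕-self c) ⟩
  0ᵛ ⊕ v       ≡⟨ zipWith-identityˡ xor-identityˡ v ⟩
  v            ∎
  where open ≡-Reasoning

⊕-transpose : (c : Vec Bool n) {u v : Vec Bool n} → c ⊕ u ≡ v → u ≡ c ⊕ v
⊕-transpose c {u} eq = trans (sym (⊕-cancelˡ c u)) (cong (c ⊕_) eq)

⊕-injectiveʳ : (c : Vec Bool n) {u v : Vec Bool n} → c ⊕ u ≡ c ⊕ v → u ≡ v
⊕-injectiveʳ c {v = v} eq = trans (⊕-transpose c eq) (⊕-cancelˡ c v)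

⊕-transpose⁻ : (c : Vec Bool n) {u v : Vec Bool n} → u ≡ c ⊕ v → c ⊕ u ≡ v
⊕-transpose⁻ c {v = v} eq = trans (cong (c ⊕_) eq) (⊕-cancelˡ c v)

flipAt-⊕ : (c v : Vec Bool n) (i : Fin n) → flipAt (c ⊕ v) i ≡ c ⊕ flipAt v i
flipAt-⊕ (a ∷ c) (b ∷ v) zero    = cong (_∷ _) (not-distribʳ-xor a b)
flipAt-⊕ (a ∷ c) (b ∷ v) (suc i) = cong (_ ∷_) (flipAt-⊕ c v i)

DiffIn-flipAt : (u : V) (i : Fin 3) → DiffIn i u (flipAt u i)
DiffIn-flipAt u i = (λ eq → not-¬ refl (trans eq (lookup∘updateAt i u)))
                  , (λ j j≢i → sym (lookup∘updateAt′ j i j≢i u))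

DiffIn⇒≡flipAt : {i : Fin 3} {u v : V} → DiffIn i u v → v ≡ flipAt u i
DiffIn⇒≡flipAt {i} {u} {v} (uᵢ≢vᵢ , same) = Pointwise-≡⇒≡ (ext pointwise)
  where
  pointwise : ∀ j → lookup v j ≡ lookup (flipAt u i) j
  pointwise j with j ≟ᶠ i
  ... | yes refl = trans (¬-not (uᵢ≢vᵢ ∘ sym)) (sym (lookup∘updateAt i u))
  ... | no j≢i   = trans (sym (same j j≢i)) (sym (lookup∘updateAt′ j i j≢i u))

DiffIn-⊕ : (t : V) {i : Fin 3} {u v : V} → DiffIn i u v → DiffIn i (t ⊕ u) (t ⊕ v)
DiffIn-⊕ t {i} {u} d = subst (DiffIn i (t ⊕ u))
  (trans (flipAt-⊕ t u i) (cong (t ⊕_) (sym (DiffIn⇒≡flipAt d))))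
  (DiffIn-flipAt (t ⊕ u) i)

-- Walks along direction words

walk : Vec Bool m → Vec (Fin m) n → Fin (suc n) → Vec Bool m
walk v ds       zero    = v
walk v (i ∷ ds) (suc k) = walk (flipAt v i) ds k

walk-suc : (v : Vec Bool m) (ds : Vec (Fin m) n) (k : Fin n) →
           walk v ds (suc k) ≡ flipAt (walk v ds (inject₁ k)) (lookup ds k)
walk-suc v (i ∷ ds) zero    = refl
walk-suc v (i ∷ ds) (suc k) = walk-suc (flipAt v i) ds k

walk-unique : (ds : Vec (Fin m) n) (w : Fin (suc n) → Vec Bool m) →
              (∀ k → w (suc k) ≡ flipAt (w (inject₁ k)) (lookup ds k)) →
              ∀ k → w k ≡ walk (w zero) ds k
walk-unique ds       w moves zero    = refl
walk-unique (i ∷ ds) w moves (suc k) =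
  trans (walk-unique ds (w ∘ suc) (moves ∘ suc) k) (cong (λ v → walk v ds k) (moves zero))

walk-⊕ : (c v : Vec Bool m) (ds : Vec (Fin m) n) (k : Fin (suc n)) →
         walk (c ⊕ v) ds k ≡ c ⊕ walk v ds k
walk-⊕ c v ds       zero    = refl
walk-⊕ c v (i ∷ ds) (suc k) =
  trans (cong (λ u → walk u ds k) (flipAt-⊕ c v i)) (walk-⊕ c (flipAt v i) ds k)

walk-translate : (c : Vec Bool m) (ds : Vec (Fin m) n) (k : Fin (suc n)) →
                 walk c ds k ≡ c ⊕ walk 0ᵛ ds k
walk-translate c ds k = trans (cong (λ u → walk u ds k) (sym (⊕-identityʳ c))) (walk-⊕ c 0ᵛ ds k)

Word : Set
Word = Vec (Fin 3) 8

cycleOf : V → Word → Fin 8 → V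
cycleOf c ds = walk c ds ∘ inject₁

Closed : V → Word → Set
Closed c ds = walk c ds (fromℕ 8) ≡ c

IsHamFrom : V → Word → Set
IsHamFrom c ds = Injective _≡_ _≡_ (cycleOf c ds) × Closed c ds

IsHamWord : Word → Set
IsHamWord = IsHamFrom 0ᵛ

cycleOf-⊕ : (t c : V) (ds : Word) (k : Fin 8) → cycleOf (t ⊕ c) ds k ≡ t ⊕ cycleOf c ds k
cycleOf-⊕ t c ds k = walk-⊕ t c ds (inject₁ k)

IsHamFrom⇒IsHamWord : (c : V) (ds : Word) → IsHamFrom c ds → IsHamWord ds
IsHamFrom⇒IsHamWord c ds (inj , closed) =
  (λ {i} {j} eq → inj (trans (walk-translate c ds (inject₁ i))
                        (trans (cong (c ⊕_) eq) (sym (walk-translate c ds (inject₁ j))))))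
  , ⊕-injectiveʳ c (trans (sym (walk-translate c ds (fromℕ 8))) (trans closed (sym (⊕-identityʳ c))))

IsHamWord⇒IsHamFrom : (c : V) (ds : Word) → IsHamWord ds → IsHamFrom c ds
IsHamWord⇒IsHamFrom c ds (inj , closed) =
  (λ {i} {j} eq → inj (⊕-injectiveʳ c (trans (sym (walk-translate c ds (inject₁ i)))
                                        (trans eq (walk-translate c ds (inject₁ j))))))
  , trans (walk-translate c ds (fromℕ 8)) (trans (cong (c ⊕_) closed) (⊕-identityʳ c))

next-inject₁ : (k : Fin 7) → next (inject₁ k) ≡ suc k
next-inject₁ zero                                     = refl
next-inject₁ (suc zero)                               = refl
next-inject₁ (suc (suc zero))                         = refl
next-inject₁ (suc (suc (suc zero)))                   = refl
next-inject₁ (suc (suc (suc (suc zero))))             = refl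
next-inject₁ (suc (suc (suc (suc (suc zero)))))       = refl
next-inject₁ (suc (suc (suc (suc (suc (suc zero)))))) = refl

cycleOf-next : (c : V) (ds : Word) → Closed c ds →
               ∀ k → cycleOf c ds (next k) ≡ flipAt (cycleOf c ds k) (lookup ds k)
cycleOf-next c ds closed k with view k
... | ‵fromℕ     = trans (sym closed) (walk-suc c ds (fromℕ 7))
... | ‵inject₁ j = trans (cong (walk c ds ∘ inject₁) (next-inject₁ j)) (walk-suc c ds (inject₁ j))

wrap : Fin 9 → Fin 8
wrap zero    = zero
wrap (suc k) = next k

wrap-inject₁ : (k : Fin 8) → wrap (inject₁ k) ≡ k
wrap-inject₁ zero    = refl
wrap-inject₁ (suc k) = next-inject₁ k

module _ {f : Edge} (C : HamCycle f) where

  directions : Word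
  directions = tabulate (proj₁ ∘ adj C)

  private
    cyc-next : ∀ k → cyc C (next k) ≡ flipAt (cyc C k) (lookup directions k)
    cyc-next k = trans (DiffIn⇒≡flipAt (proj₂ (adj C k)))
                       (cong (flipAt (cyc C k)) (sym (lookup∘tabulate (proj₁ ∘ adj C) k)))

    -- Reading the cycle with indices in Fin 9 makes it a walk whose last vertex is the first.
    cyc∘wrap≡walk : ∀ k → cyc C (wrap k) ≡ walk (cyc C zero) directions k
    cyc∘wrap≡walk = walk-unique directions (cyc C ∘ wrap) λ k →
      trans (cyc-next k) (cong (λ j → flipAt (cyc C j) (lookup directions k)) (sym (wrap-inject₁ k)))

  cyc≡cycleOf : ∀ k → cyc C k ≡ cycleOf (cyc C zero) directions k
  cyc≡cycleOf k = trans (cong (cyc C) (sym (wrap-inject₁ k))) (cyc∘wrap≡walk (inject₁ k))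

  directions-IsHamWord : IsHamWord directions
  directions-IsHamWord = IsHamFrom⇒IsHamWord (cyc C zero) directions
    ( (λ {i} {j} eq → inj C (trans (cyc≡cycleOf i) (trans eq (sym (cyc≡cycleOf j)))))
    , sym (cyc∘wrap≡walk (fromℕ 8)) )

_≟ᵛ_ : DecidableEquality (Vec Bool n)
_≟ᵛ_ = ≡-decᵛ _≟ᵇ_

∀-Bool? : {P : Pred Bool 0ℓ} → Decidable P → Dec (∀ b → P b)
∀-Bool? P? = map′ (λ (t , f) → λ { true → t ; false → f }) (λ h → h true , h false) (P? true ×-dec P? false)

∃-Bool? : {P : Pred Bool 0ℓ} → Decidable P → Dec (∃ P)
∃-Bool? P? = map′ [ (true ,_) , (false ,_) ] (λ { (true , t) → inj₁ t ; (false , f) → inj₂ f })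
                  (P? true ⊎-dec P? false)

module _ {A : Set} where

  ∀-Vec? : (∀ {Q : Pred A 0ℓ} → Decidable Q → Dec (∀ a → Q a)) →
           {P : Pred (Vec A n) 0ℓ} → Decidable P → Dec (∀ v → P v)
  ∀-Vec? {zero}  ∀? P? = map′ (λ p → λ { [] → p }) (λ h → h []) (P? [])
  ∀-Vec? {suc n} ∀? P? = map′ (λ h → λ { (a ∷ v) → h a v }) (λ h a v → h (a ∷ v))
                              (∀? λ a → ∀-Vec? ∀? λ v → P? (a ∷ v))

  ∃-Vec? : (∀ {Q : Pred A 0ℓ} → Decidable Q → Dec (∃ Q)) →
           {P : Pred (Vec A n) 0ℓ} → Decidable P → Dec (∃ P)
  ∃-Vec? {zero}  ∃? P? = map′ ([] ,_) (λ { ([] , p) → p }) (P? [])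
  ∃-Vec? {suc n} ∃? P? = map′ (λ (a , v , p) → a ∷ v , p) (λ { (a ∷ v , p) → a , v , p })
                              (∃? λ a → ∃-Vec? ∃? λ v → P? (a ∷ v))

∀-V? : {P : Pred V 0ℓ} → Decidable P → Dec (∀ v → P v)
∀-V? = ∀-Vec? ∀-Bool?

∃-V? : {P : Pred V 0ℓ} → Decidable P → Dec (∃ P)
∃-V? = ∃-Vec? ∃-Bool?

injective? : {A : Set} (w : Fin n → A) → DecidableEquality A → Dec (Injective _≡_ _≡_ w)
injective? w _≟_ = map′ (λ h {i} {j} → h i j) (λ h i j → h)
                        (all? λ i → all? λ j → (w i ≟ w j) →-dec (i ≟ᶠ j))

edgeAt : V → Fin 3 → Edge
edgeAt u i = edge u (flipAt u i) i (DiffIn-flipAt u i)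

edge-elim : (P : Edge → Set) → (∀ u i d → P (edge u (flipAt u i) i d)) → ∀ e → P e
edge-elim P h (edge u v i d) with DiffIn⇒≡flipAt {i} {u} {v} d
... | refl = h u i d

SamePair? : (a b c d : V) → Dec (SamePair a b c d)
SamePair? a b c d = ((a ≟ᵛ c) ×-dec (b ≟ᵛ d)) ⊎-dec ((a ≟ᵛ d) ×-dec (b ≟ᵛ c))

SameEdge? : (e e′ : Edge) → Dec (SameEdge e e′)
SameEdge? e e′ = SamePair? (x e) (y e) (x e′) (y e′)

IsEnd? : (v : V) (e : Edge) → Dec (IsEnd v e)
IsEnd? v e = (v ≟ᵛ x e) ⊎-dec (v ≟ᵛ y e)

∃-IsEnd? : {P : Pred V 0ℓ} → Decidable P → (e : Edge) → Dec (∃ λ v → IsEnd v e × P v)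
∃-IsEnd? P? e = map′ [ (λ p → x e , inj₁ refl , p) , (λ p → y e , inj₂ refl , p) ]
                     (λ { (_ , inj₁ refl , p) → inj₁ p ; (_ , inj₂ refl , p) → inj₂ p })
                     (P? (x e) ⊎-dec P? (y e))

ShareEnd? : (e e′ : Edge) → Dec (ShareEnd e e′)
ShareEnd? e e′ = ∃-IsEnd? (λ v → IsEnd? v e′) e

WalkLe? : ∀ n (u v : V) → Dec (WalkLe n u v)
WalkLe? zero    u v = map′ (λ { refl → stay }) (λ { stay → refl }) (u ≟ᵛ v)
WalkLe? (suc n) u v = map′ [ (λ { refl → stay }) , (λ (i , w) → step (i , DiffIn-flipAt u i) w) ]
                           (λ { stay → inj₁ refl
                              ; (step (i , d) w) →
                                  inj₂ (i , subst (λ t → WalkLe n t v) (DiffIn⇒≡flipAt d) w) })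
                           ((u ≟ᵛ v) ⊎-dec any? λ i → WalkLe? n (flipAt u i) v)

EdgeDistLe? : ∀ n (e e′ : Edge) → Dec (EdgeDistLe n e e′)
EdgeDistLe? n e e′ = map′ (λ (a , a∈e , b , b∈e′ , w) → a , b , a∈e , b∈e′ , w)
                          (λ (a , b , a∈e , b∈e′ , w) → a , a∈e , b , b∈e′ , w)
                          (∃-IsEnd? (λ a → ∃-IsEnd? (λ b → WalkLe? n a b) e′) e)

Matching2? : (f e₁ e₂ : Edge) → Dec (Matching2 f e₁ e₂)
Matching2? f e₁ e₂ = ¬? (SameEdge? e₁ f) ×-dec ¬? (SameEdge? e₂ f) ×-dec ¬? (ShareEnd? e₁ e₂)

Exception1? : (f e₁ e₂ : Edge) → Dec (Exception1 f e₁ e₂)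
Exception1? f e₁ e₂ = (dim e₁ ≟ᶠ dim e₂)
               ×-dec (EdgeDistLe? 2 e₁ e₂ ×-dec ¬? (EdgeDistLe? 1 e₁ e₂))
               ×-dec (dim f ≟ᶠ dim e₁)

FreeEdge? : (c : Fin 3) (e₁ e₂ g : Edge) → Dec (FreeEdge c e₁ e₂ g)
FreeEdge? c e₁ e₂ g = (dim g ≟ᶠ c) ×-dec ¬? (ShareEnd? g e₁) ×-dec ¬? (ShareEnd? g e₂)

Exception2? : (f e₁ e₂ : Edge) → Dec (Exception2 f e₁ e₂)
Exception2? f e₁ e₂ = ¬? (dim e₁ ≟ᶠ dim e₂) ×-dec any? λ c →
  ¬? (c ≟ᶠ dim e₁) ×-dec ¬? (c ≟ᶠ dim e₂) ×-dec FreeEdge? c e₁ e₂ f ×-dec onlyFreeEdge? c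
  where
  onlyFreeEdge? : ∀ c → Dec (∀ g → FreeEdge c e₁ e₂ g → SameEdge g f)
  onlyFreeEdge? c = map′ (λ h → edge-elim _ λ u i _ → h u i) (λ h u i → h (edgeAt u i))
    (∀-V? λ u → all? λ i → FreeEdge? c e₁ e₂ (edgeAt u i) →-dec SameEdge? (edgeAt u i) f)

Exceptional : Edge → Edge → Edge → Set
Exceptional f e₁ e₂ = Exception1 f e₁ e₂ ⊎ Exception2 f e₁ e₂

Exceptional? : (f e₁ e₂ : Edge) → Dec (Exceptional f e₁ e₂)
Exceptional? f e₁ e₂ = Exception1? f e₁ e₂ ⊎-dec Exception2? f e₁ e₂

-- Agda checks [refl : does a? ≡ true] with far less time and memory than [tt : True a?].
decided : {A : Set} (a? : Dec A) → does a? ≡ true → A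
decided (yes a) _ = a

-- The Hamiltonian cycles of Q₃

IsHamWord? : (ds : Word) → Dec (IsHamWord ds)
IsHamWord? ds = injective? (cycleOf 0ᵛ ds) _≟ᵛ_ ×-dec (walk 0ᵛ ds (fromℕ 8) ≟ᵛ 0ᵛ)

_≟ʷ_ : DecidableEquality Word
_≟ʷ_ = ≡-decᵛ _≟ᶠ_

open import Data.List.Membership.DecPropositional _≟ʷ_ using (_∈?_)

period² : (a b c d : Fin 3) → Word
period² a b c d = a ∷ b ∷ c ∷ d ∷ a ∷ b ∷ c ∷ d ∷ []

-- The reflected Gray code (a b a c)² and its cyclic shift (a b c b)², for each order of the dimensions.
hamWords : List Word
hamWords = period² (# 0) (# 1) (# 0) (# 2) ∷ period² (# 0) (# 2) (# 0) (# 1)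
         ∷ period² (# 1) (# 0) (# 1) (# 2) ∷ period² (# 1) (# 2) (# 1) (# 0)
         ∷ period² (# 2) (# 0) (# 2) (# 1) ∷ period² (# 2) (# 1) (# 2) (# 0)
         ∷ period² (# 0) (# 1) (# 2) (# 1) ∷ period² (# 0) (# 2) (# 1) (# 2)
         ∷ period² (# 1) (# 0) (# 2) (# 0) ∷ period² (# 1) (# 2) (# 0) (# 2)
         ∷ period² (# 2) (# 0) (# 1) (# 0) ∷ period² (# 2) (# 1) (# 0) (# 1) ∷ []

hamWords-IsHamWord : All IsHamWord hamWords
hamWords-IsHamWord = decided (All.all? IsHamWord? hamWords) refl

IsHamWord⇒∈hamWords : ∀ ds → IsHamWord ds → ds ∈ hamWords
IsHamWord⇒∈hamWords = decided (∀-Vec? (λ Q? → all? Q?) λ ds → IsHamWord? ds →-dec (ds ∈? hamWords)) refl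

Contains : (Fin 8 → V) → Edge → Set
Contains w e = ∃ λ k → SamePair (w k) (w (next k)) (x e) (y e)

Avoids : (Fin 8 → V) → Edge → Set
Avoids w f = ∀ k → ¬ SamePair (w k) (w (next k)) (x f) (y f)

Threads : Edge → Edge → Edge → (Fin 8 → V) → Set
Threads f e₁ e₂ w = Contains w e₁ × Contains w e₂ × Avoids w f

Threads? : (f e₁ e₂ : Edge) (w : Fin 8 → V) → Dec (Threads f e₁ e₂ w)
Threads? f e₁ e₂ w =
  contains? e₁ ×-dec contains? e₂ ×-dec all? λ k → ¬? (SamePair? (w k) (w (next k)) (x f) (y f))
  where
  contains? : ∀ e → Dec (Contains w e)
  contains? e = any? λ k → SamePair? (w k) (w (next k)) (x e) (y e)

Threads-resp : ∀ {f e₁ e₂} {w w′ : Fin 8 → V} → (∀ k → w k ≡ w′ k) → Threads f e₁ e₂ w → Threads f e₁ e₂ w′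
Threads-resp {w = w} {w′} w≗w′ ((k₁ , s₁) , (k₂ , s₂) , avoids) =
  (k₁ , move s₁) , (k₂ , move s₂) , λ k → avoids k ∘ move⁻
  where
  move : ∀ {k c d} → SamePair (w k) (w (next k)) c d → SamePair (w′ k) (w′ (next k)) c d
  move {k} {c} {d} = subst₂ (λ a b → SamePair a b c d) (w≗w′ k) (w≗w′ (next k))
  move⁻ : ∀ {k c d} → SamePair (w′ k) (w′ (next k)) c d → SamePair (w k) (w (next k)) c d
  move⁻ {k} {c} {d} = subst₂ (λ a b → SamePair a b c d) (sym (w≗w′ k)) (sym (w≗w′ (next k)))

Extendable : Edge → Edge → Edge → Set
Extendable f e₁ e₂ = ∃ λ c → Any (Threads f e₁ e₂ ∘ cycleOf c) hamWords

Extendable? : (f e₁ e₂ : Edge) → Dec (Extendable f e₁ e₂)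
Extendable? f e₁ e₂ = ∃-V? λ c → Any.any? (Threads? f e₁ e₂ ∘ cycleOf c) hamWords

Dichotomy : Edge → Edge → Edge → Set
Dichotomy f e₁ e₂ = Matching2 f e₁ e₂ →
  (Exceptional f e₁ e₂ ⊎ Extendable f e₁ e₂) × ¬ (Exceptional f e₁ e₂ × Extendable f e₁ e₂)

Dichotomy? : (f e₁ e₂ : Edge) → Dec (Dichotomy f e₁ e₂)
Dichotomy? f e₁ e₂ = Matching2? f e₁ e₂ →-dec
  ((Exceptional? f e₁ e₂ ⊎-dec Extendable? f e₁ e₂) ×-dec ¬? (Exceptional? f e₁ e₂ ×-dec Extendable? f e₁ e₂))

IsHamFrom⇒HamCycle : ∀ {f} c ds → IsHamFrom c ds → Avoids (cycleOf c ds) f → HamCycle f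
IsHamFrom⇒HamCycle c ds (inj , closed) avoids = record
  { cyc   = cycleOf c ds
  ; inj   = inj
  ; adj   = λ k → lookup ds k , subst (DiffIn (lookup ds k) (cycleOf c ds k))
                                        (sym (cycleOf-next c ds closed k))
                                        (DiffIn-flipAt (cycleOf c ds k) (lookup ds k))
  ; avoid = avoids
  }

Extendable⇒HamCycle : ∀ {f e₁ e₂} → Extendable f e₁ e₂ →
                      Σ (HamCycle f) λ C → CycleContains C e₁ × CycleContains C e₂
Extendable⇒HamCycle (c , threading) with find threading
... | ds , ds∈ , (c₁ , c₂ , avoids) =
  IsHamFrom⇒HamCycle c ds (IsHamWord⇒IsHamFrom c ds (All.lookup hamWords-IsHamWord ds∈)) avoids , c₁ , c₂

HamCycle⇒Extendable : ∀ {f e₁ e₂} (C : HamCycle f) → CycleContains C e₁ → CycleContains C e₂ →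
                      Extendable f e₁ e₂
HamCycle⇒Extendable {f} {e₁} {e₂} C c₁ c₂ =
  cyc C zero , lose {P = Threads f e₁ e₂ ∘ cycleOf (cyc C zero)}
                    (IsHamWord⇒∈hamWords (directions C) (directions-IsHamWord C))
                    (Threads-resp {f} {e₁} {e₂} (cyc≡cycleOf C) (c₁ , c₂ , avoid C))

-- Invariance under translations of the cube

infixl 6 _⊕ᵉ_
_⊕ᵉ_ : V → Edge → Edge
t ⊕ᵉ e = edge (t ⊕ x e) (t ⊕ y e) (dim e) (DiffIn-⊕ t (diff e))

SamePair-map : {a b c d a′ b′ c′ d′ : V} →
               (a ≡ c → a′ ≡ c′) → (b ≡ d → b′ ≡ d′) → (a ≡ d → a′ ≡ d′) → (b ≡ c → b′ ≡ c′) →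
               SamePair a b c d → SamePair a′ b′ c′ d′
SamePair-map ac bd ad bc = map⊎ (map× ac bd) (map× ad bc)

module _ (t : V) where

  private
    ⊕-cong : {u v : V} → u ≡ v → t ⊕ u ≡ t ⊕ v
    ⊕-cong = cong (t ⊕_)

    ⊕-inj : {u v : V} → t ⊕ u ≡ t ⊕ v → u ≡ v
    ⊕-inj = ⊕-injectiveʳ t

    ⊕-tr : {u v : V} → t ⊕ u ≡ v → u ≡ t ⊕ v
    ⊕-tr = ⊕-transpose t

    ⊕-tr⁻ : {u v : V} → u ≡ t ⊕ v → t ⊕ u ≡ v
    ⊕-tr⁻ = ⊕-transpose⁻ t

  SamePair-⊕ : ∀ {a b c d} → SamePair a b c d → SamePair (t ⊕ a) (t ⊕ b) (t ⊕ c) (t ⊕ d)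
  SamePair-⊕ = SamePair-map ⊕-cong ⊕-cong ⊕-cong ⊕-cong

  SamePair-⊕⁻ : ∀ {a b c d} → SamePair (t ⊕ a) (t ⊕ b) (t ⊕ c) (t ⊕ d) → SamePair a b c d
  SamePair-⊕⁻ = SamePair-map ⊕-inj ⊕-inj ⊕-inj ⊕-inj

  SamePair-transpose : ∀ {a b c d} → SamePair (t ⊕ a) (t ⊕ b) c d → SamePair a b (t ⊕ c) (t ⊕ d)
  SamePair-transpose = SamePair-map ⊕-tr ⊕-tr ⊕-tr ⊕-tr

  SamePair-transpose⁻ : ∀ {a b c d} → SamePair a b (t ⊕ c) (t ⊕ d) → SamePair (t ⊕ a) (t ⊕ b) c d
  SamePair-transpose⁻ = SamePair-map ⊕-tr⁻ ⊕-tr⁻ ⊕-tr⁻ ⊕-tr⁻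

  IsEnd-⊕ : ∀ {v} e → IsEnd v e → IsEnd (t ⊕ v) (t ⊕ᵉ e)
  IsEnd-⊕ e = map⊎ ⊕-cong ⊕-cong

  IsEnd-transpose⁻ : ∀ {v} e → IsEnd v (t ⊕ᵉ e) → IsEnd (t ⊕ v) e
  IsEnd-transpose⁻ e = map⊎ ⊕-tr⁻ ⊕-tr⁻

  ShareEnd-⊕ : ∀ e e′ → ShareEnd e e′ → ShareEnd (t ⊕ᵉ e) (t ⊕ᵉ e′)
  ShareEnd-⊕ e e′ (v , p , q) = t ⊕ v , IsEnd-⊕ e p , IsEnd-⊕ e′ q

  ShareEnd-⊕⁻ : ∀ e e′ → ShareEnd (t ⊕ᵉ e) (t ⊕ᵉ e′) → ShareEnd e e′
  ShareEnd-⊕⁻ e e′ (v , p , q) = t ⊕ v , IsEnd-transpose⁻ e p , IsEnd-transpose⁻ e′ q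

  ShareEnd-transpose : ∀ g e → ShareEnd (t ⊕ᵉ g) e → ShareEnd g (t ⊕ᵉ e)
  ShareEnd-transpose g e (v , p , q) = t ⊕ v , IsEnd-transpose⁻ g p , IsEnd-⊕ e q

  WalkLe-⊕ : ∀ {n a b} → WalkLe n a b → WalkLe n (t ⊕ a) (t ⊕ b)
  WalkLe-⊕ stay             = stay
  WalkLe-⊕ (step (i , d) w) = step (i , DiffIn-⊕ t d) (WalkLe-⊕ w)

  EdgeDistLe-⊕ : ∀ {n} e e′ → EdgeDistLe n e e′ → EdgeDistLe n (t ⊕ᵉ e) (t ⊕ᵉ e′)
  EdgeDistLe-⊕ e e′ (a , b , p , q , w) = t ⊕ a , t ⊕ b , IsEnd-⊕ e p , IsEnd-⊕ e′ q , WalkLe-⊕ w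

  EdgeDistLe-⊕⁻ : ∀ {n} e e′ → EdgeDistLe n (t ⊕ᵉ e) (t ⊕ᵉ e′) → EdgeDistLe n e e′
  EdgeDistLe-⊕⁻ e e′ (a , b , p , q , w) =
    t ⊕ a , t ⊕ b , IsEnd-transpose⁻ e p , IsEnd-transpose⁻ e′ q , WalkLe-⊕ w

  module _ (f e₁ e₂ : Edge) where

    Matching2-⊕⁻ : Matching2 (t ⊕ᵉ f) (t ⊕ᵉ e₁) (t ⊕ᵉ e₂) → Matching2 f e₁ e₂
    Matching2-⊕⁻ (n₁ , n₂ , n₃) = n₁ ∘ SamePair-⊕ , n₂ ∘ SamePair-⊕ , n₃ ∘ ShareEnd-⊕ e₁ e₂

    Exception1-⊕ : Exception1 f e₁ e₂ → Exception1 (t ⊕ᵉ f) (t ⊕ᵉ e₁) (t ⊕ᵉ e₂)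
    Exception1-⊕ (d₁₂ , (≤2 , ≰1) , d₀₁) = d₁₂ , (EdgeDistLe-⊕ e₁ e₂ ≤2 , ≰1 ∘ EdgeDistLe-⊕⁻ e₁ e₂) , d₀₁

    Exception1-⊕⁻ : Exception1 (t ⊕ᵉ f) (t ⊕ᵉ e₁) (t ⊕ᵉ e₂) → Exception1 f e₁ e₂
    Exception1-⊕⁻ (d₁₂ , (≤2 , ≰1) , d₀₁) = d₁₂ , (EdgeDistLe-⊕⁻ e₁ e₂ ≤2 , ≰1 ∘ EdgeDistLe-⊕ e₁ e₂) , d₀₁

    FreeEdge-⊕ : ∀ {c} g → FreeEdge c e₁ e₂ g → FreeEdge c (t ⊕ᵉ e₁) (t ⊕ᵉ e₂) (t ⊕ᵉ g)
    FreeEdge-⊕ g (dg , n₁ , n₂) = dg , n₁ ∘ ShareEnd-⊕⁻ g e₁ , n₂ ∘ ShareEnd-⊕⁻ g e₂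

    FreeEdge-⊕⁻ : ∀ {c} g → FreeEdge c (t ⊕ᵉ e₁) (t ⊕ᵉ e₂) (t ⊕ᵉ g) → FreeEdge c e₁ e₂ g
    FreeEdge-⊕⁻ g (dg , n₁ , n₂) = dg , n₁ ∘ ShareEnd-⊕ g e₁ , n₂ ∘ ShareEnd-⊕ g e₂

    FreeEdge-transpose : ∀ {c} g → FreeEdge c (t ⊕ᵉ e₁) (t ⊕ᵉ e₂) g → FreeEdge c e₁ e₂ (t ⊕ᵉ g)
    FreeEdge-transpose g (dg , n₁ , n₂) = dg , n₁ ∘ ShareEnd-transpose g e₁ , n₂ ∘ ShareEnd-transpose g e₂

    Exception2-⊕ : Exception2 f e₁ e₂ → Exception2 (t ⊕ᵉ f) (t ⊕ᵉ e₁) (t ⊕ᵉ e₂)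
    Exception2-⊕ (d₁₂ , c , c≢₁ , c≢₂ , free , unique) =
      d₁₂ , c , c≢₁ , c≢₂ , FreeEdge-⊕ f free ,
      λ g free′ → SamePair-transpose (unique (t ⊕ᵉ g) (FreeEdge-transpose g free′))

    Exception2-⊕⁻ : Exception2 (t ⊕ᵉ f) (t ⊕ᵉ e₁) (t ⊕ᵉ e₂) → Exception2 f e₁ e₂
    Exception2-⊕⁻ (d₁₂ , c , c≢₁ , c≢₂ , free , unique) =
      d₁₂ , c , c≢₁ , c≢₂ , FreeEdge-⊕⁻ f free ,
      λ g free′ → SamePair-⊕⁻ (unique (t ⊕ᵉ g) (FreeEdge-⊕ g free′))

    Threads-⊕ : ∀ {w} → Threads f e₁ e₂ w → Threads (t ⊕ᵉ f) (t ⊕ᵉ e₁) (t ⊕ᵉ e₂) ((t ⊕_) ∘ w)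
    Threads-⊕ ((k₁ , s₁) , (k₂ , s₂) , avoids) =
      (k₁ , SamePair-⊕ s₁) , (k₂ , SamePair-⊕ s₂) , λ k → avoids k ∘ SamePair-⊕⁻

    Threads-⊕⁻ : ∀ {w} → Threads (t ⊕ᵉ f) (t ⊕ᵉ e₁) (t ⊕ᵉ e₂) w → Threads f e₁ e₂ ((t ⊕_) ∘ w)
    Threads-⊕⁻ ((k₁ , s₁) , (k₂ , s₂) , avoids) =
      (k₁ , SamePair-transpose⁻ s₁) , (k₂ , SamePair-transpose⁻ s₂) , λ k → avoids k ∘ SamePair-transpose

    Extendable-⊕ : Extendable f e₁ e₂ → Extendable (t ⊕ᵉ f) (t ⊕ᵉ e₁) (t ⊕ᵉ e₂)
    Extendable-⊕ (c , threading) =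
      t ⊕ c , Any.map (λ {ds} → Threads-resp {t ⊕ᵉ f} {t ⊕ᵉ e₁} {t ⊕ᵉ e₂} (sym ∘ cycleOf-⊕ t c ds)
                                ∘ Threads-⊕) threading

    Extendable-⊕⁻ : Extendable (t ⊕ᵉ f) (t ⊕ᵉ e₁) (t ⊕ᵉ e₂) → Extendable f e₁ e₂
    Extendable-⊕⁻ (c , threading) =
      t ⊕ c , Any.map (λ {ds} → Threads-resp {f} {e₁} {e₂} (sym ∘ cycleOf-⊕ t c ds) ∘ Threads-⊕⁻) threading

    Dichotomy-⊕ : Dichotomy f e₁ e₂ → Dichotomy (t ⊕ᵉ f) (t ⊕ᵉ e₁) (t ⊕ᵉ e₂)
    Dichotomy-⊕ dichotomy m with dichotomy (Matching2-⊕⁻ m)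
    ... | exceptional⊎extendable , exclusive =
      map⊎ (map⊎ Exception1-⊕ Exception2-⊕) Extendable-⊕ exceptional⊎extendable ,
      λ (exceptional , extendable) →
        exclusive (map⊎ Exception1-⊕⁻ Exception2-⊕⁻ exceptional , Extendable-⊕⁻ extendable)

infix 4 _≈ᵉ_
record _≈ᵉ_ (e e′ : Edge) : Set where
  constructor same-endpoints
  field
    x≡   : x e ≡ x e′
    y≡   : y e ≡ y e′
    dim≡ : dim e ≡ dim e′

-- Dichotomy never inspects the proof field of an edge, so it is invariant under ≈ᵉ.
Dichotomy-cong : ∀ {f f′ e₁ e₁′ e₂ e₂′} → f ≈ᵉ f′ → e₁ ≈ᵉ e₁′ → e₂ ≈ᵉ e₂′ →
                 Dichotomy f e₁ e₂ → Dichotomy f′ e₁′ e₂′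
Dichotomy-cong {edge _ _ _ _} {edge _ _ _ _} {edge _ _ _ _} {edge _ _ _ _} {edge _ _ _ _} {edge _ _ _ _}
  (same-endpoints refl refl refl) (same-endpoints refl refl refl) (same-endpoints refl refl refl) dichotomy =
  dichotomy

≈ᵉ-refl : ∀ e → e ≈ᵉ e
≈ᵉ-refl e = same-endpoints refl refl refl

edgeAt-≈ᵉ : ∀ e → edgeAt (x e) (dim e) ≈ᵉ e
edgeAt-≈ᵉ e = same-endpoints refl (sym (DiffIn⇒≡flipAt (diff e))) refl

⊕ᵉ-involutive : ∀ t e → t ⊕ᵉ (t ⊕ᵉ e) ≈ᵉ e
⊕ᵉ-involutive t e = same-endpoints (⊕-cancelˡ t (x e)) (⊕-cancelˡ t (y e)) refl

⊕ᵉ-edgeAt-origin : ∀ f → x f ⊕ᵉ edgeAt 0ᵛ (dim f) ≈ᵉ f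
⊕ᵉ-edgeAt-origin (edge u v i d) = same-endpoints (⊕-identityʳ u) u⊕e≡v refl
  where
  open ≡-Reasoning
  u⊕e≡v : u ⊕ flipAt 0ᵛ i ≡ v
  u⊕e≡v = begin
    u ⊕ flipAt 0ᵛ i  ≡⟨ flipAt-⊕ u 0ᵛ i ⟨
    flipAt (u ⊕ 0ᵛ) i ≡⟨ cong (λ w → flipAt w i) (⊕-identityʳ u) ⟩
    flipAt u i        ≡⟨ DiffIn⇒≡flipAt d ⟨
    v                 ∎

DichotomyTable : Fin 3 → Set
DichotomyTable i = ∀ u₁ i₁ u₂ i₂ → Dichotomy (edgeAt 0ᵛ i) (edgeAt u₁ i₁) (edgeAt u₂ i₂)

DichotomyTable? : ∀ i → Dec (DichotomyTable i)
DichotomyTable? i = ∀-V? λ u₁ → all? λ i₁ → ∀-V? λ u₂ → all? λ i₂ →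
  Dichotomy? (edgeAt 0ᵛ i) (edgeAt u₁ i₁) (edgeAt u₂ i₂)

-- One check per dimension of f keeps the memory used by each evaluation moderate.
dichotomyTable : ∀ i → DichotomyTable i
dichotomyTable zero             = decided (DichotomyTable? zero) refl
dichotomyTable (suc zero)       = decided (DichotomyTable? (suc zero)) refl
dichotomyTable (suc (suc zero)) = decided (DichotomyTable? (suc (suc zero))) refl

dichotomy-origin : ∀ i e₁ e₂ → Dichotomy (edgeAt 0ᵛ i) e₁ e₂
dichotomy-origin i e₁ e₂ = Dichotomy-cong (≈ᵉ-refl (edgeAt 0ᵛ i)) (edgeAt-≈ᵉ e₁) (edgeAt-≈ᵉ e₂)
  (dichotomyTable i (x e₁) (dim e₁) (x e₂) (dim e₂))

dichotomy : ∀ f e₁ e₂ → Dichotomy f e₁ e₂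
dichotomy f e₁ e₂ =
  Dichotomy-cong (⊕ᵉ-edgeAt-origin f) (⊕ᵉ-involutive (x f) e₁) (⊕ᵉ-involutive (x f) e₂)
    (Dichotomy-⊕ (x f) (edgeAt 0ᵛ (dim f)) (x f ⊕ᵉ e₁) (x f ⊕ᵉ e₂)
      (dichotomy-origin (dim f) (x f ⊕ᵉ e₁) (x f ⊕ᵉ e₂)))

lemma4p1 : (f e₁ e₂ : Edge) → Matching2 f e₁ e₂ →
    ((¬ (Exception1 f e₁ e₂ ⊎ Exception2 f e₁ e₂)) →
      Σ (HamCycle f) λ C → CycleContains C e₁ × CycleContains C e₂)
    × ((Exception1 f e₁ e₂ ⊎ Exception2 f e₁ e₂) →
      ¬ Σ (HamCycle f) λ C → CycleContains C e₁ × CycleContains C e₂)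
lemma4p1 f e₁ e₂ m with dichotomy f e₁ e₂ m
... | exceptional⊎extendable , exclusive =
    (λ ¬exceptional → Extendable⇒HamCycle {f} {e₁} {e₂}
                         (fromInj₂ (λ exc → contradiction exc ¬exceptional) exceptional⊎extendable))
  , (λ exceptional (C , c₁ , c₂) → exclusive (exceptional , HamCycle⇒Extendable {e₁ = e₁} {e₂} C c₁ c₂))
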